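{- Let $\chi_0,\chi_1$ be PDL formulas, $\beta$ a PDL program, and $x$ an atomic proposition not occurring in $\beta$ (it may occur in $\chi_0,\chi_1$), such that $[\beta]x\equiv(x\land\chi_0)\lor\chi_1$. Then for all PDL formulas $\rho$ and $\psi$: if $\rho\models(\chi_0\lor\chi_1)[\rho/x]$ and $\rho\models\psi$, then $\rho\models[\beta^\ast]\psi$.
   Context: PDL syntax $\phi ::= \bot \mid p \mid \lnot\phi \mid \phi\land\phi \mid [\alpha]\phi$, $\alpha ::= a \mid \tau? \mid \alpha\cup\beta \mid \alpha;\beta \mid \alpha^\ast$ with standard Kripke semantics ($R_{\alpha^\ast}$ the reflexive-transitive closure of $R_\alpha$). $\phi\models\psi$: at every state of every Kripke model where $\phi$ is true, $\psi$ is true; $\equiv$ is semantic equivalence. $\chi[\rho/x]$ denotes uniform substitution of $\rho$ for $x$ in $\chi$ (also inside programs' tests). -}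

module Defs where

open import Data.Nat using (ℕ)
open import Data.Empty using (⊥)
open import Data.Product using (_×_; Σ)
open import Data.Sum using (_⊎_)
open import Relation.Nullary using (¬_)
open import Relation.Binary.PropositionalEquality using (_≡_)
open import Relation.Binary.Construct.Closure.ReflexiveTransitive using (Star)

Atom : Set
Atom = ℕ

AProg : Set
AProg = ℕ

mutual
  data Form : Set where
    ⊥f   : Form
    var  : Atom → Form
    ¬f_  : Form → Form
    _∧f_ : Form → Form → Form
    [_]_ : Prog → Form → Form

  data Prog : Set where
    act  : AProg → Prog
    _¿   : Form → Prog
    _∪p_ : Prog → Prog → Prog
    _⨾_  : Prog → Prog → Prog
    _*   : Prog → Prog

_∨f_ : Form → Form → Form
φ ∨f ψ = ¬f ((¬f φ) ∧f (¬f ψ))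

record Model : Set₁ where
  field
    W : Set
    R : AProg → W → W → Set
    V : Atom → W → Set

open Model public

mutual
  _,_⊨_ : (M : Model) → W M → Form → Set
  M , w ⊨ ⊥f = ⊥
  M , w ⊨ var p = V M p w
  M , w ⊨ (¬f φ) = ¬ (M , w ⊨ φ)
  M , w ⊨ (φ ∧f ψ) = (M , w ⊨ φ) × (M , w ⊨ ψ)
  M , w ⊨ ([ α ] φ) = ∀ v → Rel M α w v → M , v ⊨ φ

  Rel : (M : Model) → Prog → W M → W M → Set
  Rel M (act a) w v = R M a w v
  Rel M (φ ¿) w v = (w ≡ v) × (M , w ⊨ φ)
  Rel M (α ∪p β) w v = Rel M α w v ⊎ Rel M β w v
  Rel M (α ⨾ β) w v = Σ (W M) (λ u → Rel M α w u × Rel M β u v)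
  Rel M (α *) w v = Star (Rel M α) w v

_⊨c_ : Form → Form → Set₁
φ ⊨c ψ = ∀ (M : Model) (w : W M) → M , w ⊨ φ → M , w ⊨ ψ

_≡s_ : Form → Form → Set₁
φ ≡s ψ = ∀ (M : Model) (w : W M) → (M , w ⊨ φ → M , w ⊨ ψ) × (M , w ⊨ ψ → M , w ⊨ φ)

mutual
  OccF : Atom → Form → Set
  OccF x ⊥f = ⊥
  OccF x (var p) = x ≡ p
  OccF x (¬f φ) = OccF x φ
  OccF x (φ ∧f ψ) = OccF x φ ⊎ OccF x ψ
  OccF x ([ α ] φ) = OccP x α ⊎ OccF x φ

  OccP : Atom → Prog → Set
  OccP x (act a) = ⊥
  OccP x (φ ¿) = OccF x φ
  OccP x (α ∪p β) = OccP x α ⊎ OccP x β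
  OccP x (α ⨾ β) = OccP x α ⊎ OccP x β
  OccP x (α *) = OccP x α

open import Data.Nat using (_≟_)
open import Relation.Nullary using (yes; no)

mutual
  substF : Form → Form → Atom → Form
  substF ⊥f ρ x = ⊥f
  substF (var p) ρ x with p ≟ x
  ... | yes _ = ρ
  ... | no _ = var p
  substF (¬f φ) ρ x = ¬f (substF φ ρ x)
  substF (φ ∧f ψ) ρ x = substF φ ρ x ∧f substF ψ ρ x
  substF ([ α ] φ) ρ x = [ substP α ρ x ] substF φ ρ x

  substP : Prog → Form → Atom → Prog
  substP (act a) ρ x = act a
  substP (φ ¿) ρ x = substF φ ρ x ¿
  substP (α ∪p β) ρ x = substP α ρ x ∪p substP β ρ x
  substP (α ⨾ β) ρ x = substP α ρ x ⨾ substP β ρ x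
  substP (α *) ρ x = substP α ρ x *

{-# OPTIONS --safe #-}
-- By the substitution lemma (χ[ρ/x] holds in M iff χ holds once x is reinterpreted as ρ),
-- semantic equivalence is preserved by uniform substitution. Substituting ρ for x in
-- [β]x ≡ (x ∧ χ₀) ∨ χ₁, where x does not occur in β, gives [β]ρ ≡ (ρ ∧ χ₀[ρ/x]) ∨ χ₁[ρ/x].
-- At a ρ-state the hypothesis makes the right-hand side true, so ρ is an invariant of β,
-- and the induction principle for β* carries ψ along every β*-path.
module Submission where

open import Defs
open import Data.Nat using (_≟_)
open import Data.Product using (_,_; proj₁; proj₂)
open import Data.Sum using (inj₁; inj₂)
open import Data.Product.Function.NonDependent.Propositional using (_×-⇔_)
open import Data.Sum.Function.Propositional using (_⊎-⇔_)
open import Function using (_∘_)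
open import Function.Bundles using (_⇔_; mk⇔; Equivalence)
open import Function.Construct.Identity using (⇔-id)
open import Function.Related.TypeIsomorphisms using (¬-cong-⇔)
open import Relation.Binary.Construct.Closure.ReflexiveTransitive using (ε; _◅_; map)
open import Relation.Binary.PropositionalEquality using (_≡_; refl; sym; cong; cong₂; subst₂)
open import Relation.Nullary using (¬_; yes; no; contradiction)

open Equivalence using (to; from)

substF-var-self : ∀ ρ x → substF (var x) ρ x ≡ ρ
substF-var-self ρ x with x ≟ x
... | yes _    = refl
... | no  x≢x = contradiction refl x≢x

mutual
  substF-fresh : ∀ {x} φ ρ → ¬ OccF x φ → substF φ ρ x ≡ φ
  substF-fresh ⊥f        ρ x∉ = refl
  substF-fresh {x} (var p) ρ x∉ with p ≟ x
  ... | yes p≡x = contradiction (sym p≡x) x∉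
  ... | no  _   = refl
  substF-fresh (¬f φ)    ρ x∉ = cong ¬f_ (substF-fresh φ ρ x∉)
  substF-fresh (φ ∧f ψ)  ρ x∉ = cong₂ _∧f_ (substF-fresh φ ρ (x∉ ∘ inj₁)) (substF-fresh ψ ρ (x∉ ∘ inj₂))
  substF-fresh ([ α ] φ) ρ x∉ = cong₂ [_]_ (substP-fresh α ρ (x∉ ∘ inj₁)) (substF-fresh φ ρ (x∉ ∘ inj₂))

  substP-fresh : ∀ {x} α ρ → ¬ OccP x α → substP α ρ x ≡ α
  substP-fresh (act a)  ρ x∉ = refl
  substP-fresh (φ ¿)    ρ x∉ = cong _¿ (substF-fresh φ ρ x∉)
  substP-fresh (α ∪p β) ρ x∉ = cong₂ _∪p_ (substP-fresh α ρ (x∉ ∘ inj₁)) (substP-fresh β ρ (x∉ ∘ inj₂))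
  substP-fresh (α ⨾ β)  ρ x∉ = cong₂ _⨾_ (substP-fresh α ρ (x∉ ∘ inj₁)) (substP-fresh β ρ (x∉ ∘ inj₂))
  substP-fresh (α *)    ρ x∉ = cong _* (substP-fresh α ρ x∉)

updateV : (M : Model) → Atom → Form → Atom → W M → Set
updateV M x ρ p u with p ≟ x
... | yes _ = M , u ⊨ ρ
... | no  _ = V M p u

_[_≔_] : (M : Model) → Atom → Form → Model
M [ x ≔ ρ ] = record M { V = updateV M x ρ }

module _ (M : Model) (ρ : Form) (x : Atom) where

  mutual
    ⊨-substF : ∀ φ u → (M , u ⊨ substF φ ρ x) ⇔ ((M [ x ≔ ρ ]) , u ⊨ φ)
    ⊨-substF ⊥f        u = ⇔-id _
    ⊨-substF (var p)   u with p ≟ x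
    ... | yes _ = ⇔-id _
    ... | no  _ = ⇔-id _
    ⊨-substF (¬f φ)    u = ¬-cong-⇔ (⊨-substF φ u)
    ⊨-substF (φ ∧f ψ)  u = ⊨-substF φ u ×-⇔ ⊨-substF ψ u
    ⊨-substF ([ α ] φ) u = mk⇔
      (λ h v r → to   (⊨-substF φ v) (h v (from (Rel-substP α u v) r)))
      (λ h v r → from (⊨-substF φ v) (h v (to   (Rel-substP α u v) r)))

    Rel-substP : ∀ α u v → Rel M (substP α ρ x) u v ⇔ Rel (M [ x ≔ ρ ]) α u v
    Rel-substP (act a)  u v = ⇔-id _
    Rel-substP (φ ¿)    u v = ⇔-id _ ×-⇔ ⊨-substF φ u
    Rel-substP (α ∪p β) u v = Rel-substP α u v ⊎-⇔ Rel-substP β u v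
    Rel-substP (α ⨾ β)  u v = mk⇔
      (λ (m , r , s) → m , to   (Rel-substP α u m) r , to   (Rel-substP β m v) s)
      (λ (m , r , s) → m , from (Rel-substP α u m) r , from (Rel-substP β m v) s)
    Rel-substP (α *)    u v = mk⇔
      (map (λ {s} {t} → to   (Rel-substP α s t)))
      (map (λ {s} {t} → from (Rel-substP α s t)))

≡s-substF : ∀ φ ψ ρ x → φ ≡s ψ → substF φ ρ x ≡s substF ψ ρ x
≡s-substF φ ψ ρ x φ≡ψ M u =
    from (⊨-substF M ρ x ψ u) ∘ proj₁ (φ≡ψ (M [ x ≔ ρ ]) u) ∘ to (⊨-substF M ρ x φ u)
  , from (⊨-substF M ρ x φ u) ∘ proj₂ (φ≡ψ (M [ x ≔ ρ ]) u) ∘ to (⊨-substF M ρ x ψ u)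

≡s-fixpoint-substF : ∀ χ₀ χ₁ β x → ¬ OccP x β → ([ β ] var x) ≡s ((var x ∧f χ₀) ∨f χ₁) →
  ∀ ρ → ([ β ] ρ) ≡s ((ρ ∧f substF χ₀ ρ x) ∨f substF χ₁ ρ x)
≡s-fixpoint-substF χ₀ χ₁ β x x∉β fixpoint ρ =
  subst₂ (λ β′ ρ′ → ([ β′ ] ρ′) ≡s ((ρ′ ∧f substF χ₀ ρ x) ∨f substF χ₁ ρ x))
         (substP-fresh β ρ x∉β) (substF-var-self ρ x)
         (≡s-substF ([ β ] var x) ((var x ∧f χ₀) ∨f χ₁) ρ x fixpoint)

⊨c-[]-invariant : ∀ χ₀ χ₁ β x → ¬ OccP x β → ([ β ] var x) ≡s ((var x ∧f χ₀) ∨f χ₁) →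
  ∀ ρ → ρ ⊨c substF (χ₀ ∨f χ₁) ρ x → ρ ⊨c ([ β ] ρ)
⊨c-[]-invariant χ₀ χ₁ β x x∉β fixpoint ρ ρ⊨χ M w ρw =
  proj₂ (≡s-fixpoint-substF χ₀ χ₁ β x x∉β fixpoint ρ M w)
        (λ (¬ρχ₀ , ¬χ₁) → ρ⊨χ M w ρw ((λ χ₀w → ¬ρχ₀ (ρw , χ₀w)) , ¬χ₁))

⊨c-[*]-induction : ∀ ρ ψ β → ρ ⊨c ([ β ] ρ) → ρ ⊨c ψ → ρ ⊨c ([ β * ] ψ)
⊨c-[*]-induction ρ ψ β invariant ρ⊨ψ M w ρw .w ε        = ρ⊨ψ M w ρw
⊨c-[*]-induction ρ ψ β invariant ρ⊨ψ M w ρw v  (r ◅ rs) =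
  ⊨c-[*]-induction ρ ψ β invariant ρ⊨ψ M _ (invariant M w ρw _ r) v rs

lemma3p12 : (χ₀ χ₁ : Form) (β : Prog) (x : Atom)
    → ¬ OccP x β
    → ([ β ] var x) ≡s ((var x ∧f χ₀) ∨f χ₁)
    → (ρ ψ : Form)
    → ρ ⊨c substF (χ₀ ∨f χ₁) ρ x
    → ρ ⊨c ψ
    → ρ ⊨c ([ β * ] ψ)
lemma3p12 χ₀ χ₁ β x x∉β fixpoint ρ ψ ρ⊨χ ρ⊨ψ =
  ⊨c-[*]-induction ρ ψ β (⊨c-[]-invariant χ₀ χ₁ β x x∉β fixpoint ρ ρ⊨χ) ρ⊨ψ
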